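{- Let $G$ be a graph and let $v,w,x$ be vertices of $G$ such that $v$ is adjacent only to $w$, and $w$ is adjacent only to $v$ and $x$. If $F$ is a minimal fort of $G$ with $v,w\in F$, then $F\setminus\{v,w,x\}$ is a minimal fort of $G-\{v,w,x\}$.
   Context: A fort of a finite simple graph $G$ is a nonempty set $F\subseteq V(G)$ such that every vertex not in $F$ is adjacent to either zero or at least two vertices of $F$; it is minimal if no proper subset is a fort. -}

module Defs where

open import Data.Bool using (Bool; true; false)
open import Data.Nat using (ℕ; _≤_)
open import Data.Fin using (Fin)
open import Data.Fin.Subset using (Subset; _∈_; _∉_; _⊆_; _⊂_; _∩_; _─_; ∁; ∣_∣; Nonempty; ⁅_⁆; _∪_; ⊤)
open import Data.Vec using (tabulate)
open import Data.Sum using (_⊎_)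
open import Data.Product using (_×_)
open import Relation.Nullary using (¬_)
open import Relation.Binary.PropositionalEquality using (_≡_)

record Graph (n : ℕ) : Set where
  field
    adj    : Fin n → Fin n → Bool
    sym    : ∀ i j → adj i j ≡ adj j i
    irrefl : ∀ i → adj i i ≡ false

open Graph public

Adjacent : ∀ {n} → Graph n → Fin n → Fin n → Set
Adjacent G u u' = adj G u u' ≡ true

N : ∀ {n} → Graph n → Fin n → Subset n
N G u = tabulate (adj G u)

-- Fort of the induced subgraph G[S] (vertex set S, edges of G among S):
-- a nonempty F ⊆ S such that every vertex of S not in F is adjacent
-- to either zero or at least two vertices of F.
-- (Neighbours in F are automatically in S, since F ⊆ S.)
FortIn : ∀ {n} → Graph n → Subset n → Subset n → Set
FortIn G S F =
  F ⊆ S × Nonempty F ×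
  (∀ u → u ∈ S → u ∉ F → (∣ N G u ∩ F ∣ ≡ 0 ⊎ 2 ≤ ∣ N G u ∩ F ∣))

MinimalFortIn : ∀ {n} → Graph n → Subset n → Subset n → Set
MinimalFortIn G S F = FortIn G S F × (∀ F' → F' ⊂ F → ¬ FortIn G S F')

Fort : ∀ {n} → Graph n → Subset n → Set
Fort G = FortIn G ⊤

MinimalFort : ∀ {n} → Graph n → Subset n → Set
MinimalFort G = MinimalFortIn G ⊤

-- The vertex set of G - X, i.e. G - X is the induced subgraph G[V ∖ X].
Delete : ∀ {n} → Subset n → Subset n
Delete X = ∁ X

triple : ∀ {n} → Fin n → Fin n → Fin n → Subset n
triple v w x = ⁅ v ⁆ ∪ (⁅ w ⁆ ∪ ⁅ x ⁆)

{-# OPTIONS --safe #-}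
-- Since N(w) = {v, x} and v ∈ F, minimality forces x ∉ F: otherwise F ∖ {w} would already be a
-- fort.  No vertex outside T = {v, w, x} sees v or w, so F ∖ T is a fort of G − T; it is nonempty
-- because x ∉ F sees w ∈ F and hence a second vertex of F, which lies outside T.  Conversely a
-- fort H ⊂ F ∖ T of G − T lifts to a fort of G strictly inside F: H itself if x has no neighbour
-- in H, and H ∪ {v, w} otherwise.
module Submission where

open import Defs hiding (sym)
open import Data.Nat using (ℕ; _≤_; _<_)
open import Data.Nat.Properties using (≤-trans; <⇒≢; <⇒≱)
open import Data.Fin using (Fin; _≟_)
open import Data.Fin.Subset
  using (Subset; _∈_; _∉_; _⊆_; _⊂_; _∩_; _∪_; _─_; _-_; ∣_∣; Nonempty; Empty; ⁅_⁆; ⊤; ⊥; outside)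
open import Data.Fin.Subset.Properties
  using ( _∈?_; nonempty?; Empty-unique; ∣⊥∣≡0; ∈⊤; ∉⊥; x∈⁅x⁆; x∈⁅y⁆⇒x≡y; x∉⁅y⁆⇒x≢y; ∣⁅x⁆∣≡1
        ; ⊆-antisym; p⊆q⇒∣p∣≤∣q∣; p⊂q⇒∣p∣<∣q∣; ⊂-⊆-trans; x∈∁p⇒x∉p; x∉p⇒x∈∁p; x∈p∩q⁺; x∈p∩q⁻
        ; x∈p∪q⁺; x∈p∪q⁻; p⊆p∪q; q⊆p∪q; ∪-identityʳ; x∈p∧x∉q⇒x∈p─q; p─q⊆p; x∈p∧x≢y⇒x∈p-y; x∈p⇒p-x⊂p )
open import Data.Vec using (_∷_; here; there)
open import Data.Vec.Properties using ([]=⇒lookup; lookup⇒[]=; lookup∘tabulate)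
open import Data.Sum using (_⊎_; inj₁; inj₂; [_,_]′)
open import Data.Product using (_×_; _,_; proj₁; proj₂; ∃; uncurry)
open import Function using (id; _∘_)
open import Function.Bundles using (_⇔_; module Equivalence)
open import Relation.Nullary using (¬_; yes; no; contradiction)
open import Relation.Binary.PropositionalEquality using (_≡_; _≢_; refl; sym; trans; cong; subst)

open Equivalence using (to; from)

ZeroOrAtLeastTwo : ℕ → Set
ZeroOrAtLeastTwo k = k ≡ 0 ⊎ 2 ≤ k

x∈p─q⇒x∉q : ∀ {n} (p q : Subset n) {x} → x ∈ p ─ q → x ∉ q
x∈p─q⇒x∉q (_ ∷ p) (outside ∷ q) here       ()
x∈p─q⇒x∉q (_ ∷ p) (_ ∷ q)       (there x∈) (there x∈q) = x∈p─q⇒x∉q p q x∈ x∈q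

module _ {n : ℕ} where

  Empty⇒∣p∣≡0 : ∀ {p : Subset n} → Empty p → ∣ p ∣ ≡ 0
  Empty⇒∣p∣≡0 empty = trans (cong ∣_∣ (Empty-unique empty)) (∣⊥∣≡0 n)

  x∈p⇒⁅x⁆⊆p : ∀ {x} {p : Subset n} → x ∈ p → ⁅ x ⁆ ⊆ p
  x∈p⇒⁅x⁆⊆p {x} {p} x∈p y∈ = subst (_∈ p) (sym (x∈⁅y⁆⇒x≡y x y∈)) x∈p

  x∈p⇒0<∣p∣ : ∀ {x} {p : Subset n} → x ∈ p → 0 < ∣ p ∣
  x∈p⇒0<∣p∣ {x} x∈p = subst (_≤ _) (∣⁅x⁆∣≡1 x) (p⊆q⇒∣p∣≤∣q∣ (x∈p⇒⁅x⁆⊆p x∈p))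

  x∈p∧y∈p∧x≢y⇒2≤∣p∣ : ∀ {x y} {p : Subset n} → x ∈ p → y ∈ p → x ≢ y → 2 ≤ ∣ p ∣
  x∈p∧y∈p∧x≢y⇒2≤∣p∣ {x} {y} x∈p y∈p x≢y =
    subst (_< _) (∣⁅x⁆∣≡1 x)
      (p⊂q⇒∣p∣<∣q∣ (x∈p⇒⁅x⁆⊆p x∈p , y , y∈p , x≢y ∘ sym ∘ x∈⁅y⁆⇒x≡y x))

  2≤∣p∣⇒∃≢ : ∀ {x} {p : Subset n} → 2 ≤ ∣ p ∣ → ∃ λ y → y ∈ p × y ≢ x
  2≤∣p∣⇒∃≢ {x} {p} 2≤∣p∣ with nonempty? (p - x)
  ... | yes (y , y∈) = y , p─q⊆p p ⁅ x ⁆ y∈ , x∉⁅y⁆⇒x≢y (x∈p─q⇒x∉q p ⁅ x ⁆ y∈)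
  ... | no p-x-empty = contradiction ∣p∣≤1 (<⇒≱ 2≤∣p∣)
    where
    p⊆⁅x⁆ : p ⊆ ⁅ x ⁆
    p⊆⁅x⁆ {y} y∈p with y ≟ x
    ... | yes refl = x∈⁅x⁆ x
    ... | no y≢x   = contradiction (y , x∈p∧x≢y⇒x∈p-y y∈p y≢x) p-x-empty
    ∣p∣≤1 : ∣ p ∣ ≤ 1
    ∣p∣≤1 = subst (∣ p ∣ ≤_) (∣⁅x⁆∣≡1 x) (p⊆q⇒∣p∣≤∣q∣ p⊆⁅x⁆)

  q⊂p─r⇒q∪s⊂p : ∀ {p q r s : Subset n} → q ⊂ p ─ r → s ⊆ p → s ⊆ r → q ∪ s ⊂ p
  q⊂p─r⇒q∪s⊂p {p} {q} {r} {s} (q⊆p─r , y , y∈p─r , y∉q) s⊆p s⊆r =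
    [ p─q⊆p p r ∘ q⊆p─r , s⊆p ]′ ∘ x∈p∪q⁻ q s ,
    y , p─q⊆p p r y∈p─r , [ y∉q , x∈p─q⇒x∉q p r y∈p─r ∘ s⊆r ]′ ∘ x∈p∪q⁻ q s

  a∈triple : ∀ (a b c : Fin n) → a ∈ triple a b c
  a∈triple a b c = x∈p∪q⁺ (inj₁ (x∈⁅x⁆ a))

  b∈triple : ∀ (a b c : Fin n) → b ∈ triple a b c
  b∈triple a b c = x∈p∪q⁺ (inj₂ (x∈p∪q⁺ (inj₁ (x∈⁅x⁆ b))))

  c∈triple : ∀ (a b c : Fin n) → c ∈ triple a b c
  c∈triple a b c = x∈p∪q⁺ (inj₂ (x∈p∪q⁺ (inj₂ (x∈⁅x⁆ c))))

  ∈⁅a⁆∪⁅b⁆⁻ : ∀ {a b i : Fin n} → i ∈ ⁅ a ⁆ ∪ ⁅ b ⁆ → i ≡ a ⊎ i ≡ b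
  ∈⁅a⁆∪⁅b⁆⁻ {a} {b} i∈ with x∈p∪q⁻ ⁅ a ⁆ ⁅ b ⁆ i∈
  ... | inj₁ i∈a = inj₁ (x∈⁅y⁆⇒x≡y a i∈a)
  ... | inj₂ i∈b = inj₂ (x∈⁅y⁆⇒x≡y b i∈b)

  ∈triple⁻ : ∀ {a b c i : Fin n} → i ∈ triple a b c → i ≡ a ⊎ i ≡ b ⊎ i ≡ c
  ∈triple⁻ {a} {b} {c} i∈ with x∈p∪q⁻ ⁅ a ⁆ (⁅ b ⁆ ∪ ⁅ c ⁆) i∈
  ... | inj₁ i∈a  = inj₁ (x∈⁅y⁆⇒x≡y a i∈a)
  ... | inj₂ i∈bc = inj₂ (∈⁅a⁆∪⁅b⁆⁻ i∈bc)

  ∉triple : ∀ {a b c i : Fin n} → i ≢ a → i ≢ b → i ≢ c → i ∉ triple a b c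
  ∉triple i≢a i≢b i≢c = [ i≢a , [ i≢b , i≢c ]′ ]′ ∘ ∈triple⁻

module _ {n : ℕ} (G : Graph n) where

  infix 4 _∼_
  _∼_ : Fin n → Fin n → Set
  _∼_ = Adjacent G

  ∼-sym : ∀ {u j} → u ∼ j → j ∼ u
  ∼-sym {u} {j} u∼j = trans (Graph.sym G j u) u∼j

  ∼⇒≢ : ∀ {u j} → u ∼ j → u ≢ j
  ∼⇒≢ {u} u∼u refl = contradiction (trans (sym u∼u) (irrefl G u)) λ ()

  ∼⇒∈N : ∀ {u j} → u ∼ j → j ∈ N G u
  ∼⇒∈N {u} {j} u∼j = lookup⇒[]= j (N G u) (trans (lookup∘tabulate (adj G u) j) u∼j)

  ∈N⇒∼ : ∀ {u j} → j ∈ N G u → u ∼ j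
  ∈N⇒∼ {u} {j} j∈ = trans (sym (lookup∘tabulate (adj G u) j)) ([]=⇒lookup j∈)

  ∈N∩⁺ : ∀ {u j} {A : Subset n} → u ∼ j → j ∈ A → j ∈ N G u ∩ A
  ∈N∩⁺ u∼j j∈A = x∈p∩q⁺ (∼⇒∈N u∼j , j∈A)

  ∈N∩⁻ : ∀ {u j} {A : Subset n} → j ∈ N G u ∩ A → u ∼ j × j ∈ A
  ∈N∩⁻ {u} {A = A} j∈ with x∈p∩q⁻ (N G u) A j∈
  ... | j∈N , j∈A = ∈N⇒∼ j∈N , j∈A

  ∣N∩∣-cong : ∀ {u} {A B : Subset n} →
              (∀ {j} → u ∼ j → j ∈ A → j ∈ B) → (∀ {j} → u ∼ j → j ∈ B → j ∈ A) →
              ∣ N G u ∩ A ∣ ≡ ∣ N G u ∩ B ∣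
  ∣N∩∣-cong {u} A⇒B B⇒A = cong ∣_∣ (⊆-antisym (restrict A⇒B) (restrict B⇒A))
    where
    restrict : ∀ {C D : Subset n} → (∀ {j} → u ∼ j → j ∈ C → j ∈ D) → N G u ∩ C ⊆ N G u ∩ D
    restrict C⇒D j∈ = let u∼j , j∈C = ∈N∩⁻ j∈ in ∈N∩⁺ u∼j (C⇒D u∼j j∈C)

  ∣N∩∣≡0 : ∀ {u} {A : Subset n} → (∀ {j} → u ∼ j → j ∉ A) → ∣ N G u ∩ A ∣ ≡ 0
  ∣N∩∣≡0 no-nbr = Empty⇒∣p∣≡0 λ (j , j∈) → let u∼j , j∈A = ∈N∩⁻ j∈ in no-nbr u∼j j∈A

  fortIn-minus : ∀ {S F : Subset n} {w} → FortIn G S F → N G w ⊆ F → 2 ≤ ∣ N G w ∣ → FortIn G S (F - w)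
  fortIn-minus {S} {F} {w} (F⊆S , _ , F-cond) Nw⊆F 2≤∣Nw∣ =
    F⊆S ∘ p─q⊆p F ⁅ w ⁆ , nonempty , cond
    where
    Nw⊆F-w : N G w ⊆ F - w
    Nw⊆F-w j∈ = x∈p∧x≢y⇒x∈p-y (Nw⊆F j∈) (∼⇒≢ (∈N⇒∼ j∈) ∘ sym)
    nonempty : Nonempty (F - w)
    nonempty = let y , y∈Nw , _ = 2≤∣p∣⇒∃≢ {x = w} 2≤∣Nw∣ in y , Nw⊆F-w y∈Nw
    cond : ∀ u → u ∈ S → u ∉ F - w → ZeroOrAtLeastTwo ∣ N G u ∩ (F - w) ∣
    cond u u∈S u∉F-w with u ≟ w
    ... | yes refl = inj₂ (≤-trans 2≤∣Nw∣ (p⊆q⇒∣p∣≤∣q∣ λ j∈ → x∈p∩q⁺ (j∈ , Nw⊆F-w j∈)))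
    ... | no u≢w = subst ZeroOrAtLeastTwo (∣N∩∣-cong F⇒F-w (λ _ → p─q⊆p F ⁅ w ⁆)) (F-cond u u∈S u∉F)
      where
      u∉F : u ∉ F
      u∉F u∈F = u∉F-w (x∈p∧x≢y⇒x∈p-y u∈F u≢w)
      F⇒F-w : ∀ {j} → u ∼ j → j ∈ F → j ∈ F - w
      F⇒F-w u∼j j∈F = x∈p∧x≢y⇒x∈p-y j∈F λ { refl → u∉F (Nw⊆F (∼⇒∈N (∼-sym u∼j))) }

  minimalFortIn⇒N⊈ : ∀ {S F : Subset n} {w} → MinimalFortIn G S F → w ∈ F → 2 ≤ ∣ N G w ∣ → ¬ (N G w ⊆ F)
  minimalFortIn⇒N⊈ (F-fort , F-minimal) w∈F 2≤∣Nw∣ Nw⊆F =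
    F-minimal _ (x∈p⇒p-x⊂p w∈F) (fortIn-minus F-fort Nw⊆F 2≤∣Nw∣)

  fortIn-second-neighbour : ∀ {S F : Subset n} {u a} → FortIn G S F → u ∈ S → u ∉ F → u ∼ a → a ∈ F →
                            ∃ λ b → u ∼ b × b ∈ F × b ≢ a
  fortIn-second-neighbour (_ , _ , F-cond) u∈S u∉F u∼a a∈F with F-cond _ u∈S u∉F
  ... | inj₁ ∣N∩F∣≡0 = contradiction (sym ∣N∩F∣≡0) (<⇒≢ (x∈p⇒0<∣p∣ (∈N∩⁺ u∼a a∈F)))
  ... | inj₂ 2≤∣N∩F∣ = let b , b∈ , b≢a = 2≤∣p∣⇒∃≢ 2≤∣N∩F∣ ; u∼b , b∈F = ∈N∩⁻ b∈ in b , u∼b , b∈F , b≢a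

  fort⇒fortIn-Delete : ∀ {F T : Subset n} → Fort G F → (∀ {u j} → u ∉ T → u ∼ j → j ∈ F → j ∉ T) →
                       Nonempty (F ─ T) → FortIn G (Delete T) (F ─ T)
  fort⇒fortIn-Delete {F} {T} (_ , _ , F-cond) F-nbr∉T F─T-nonempty =
    x∉p⇒x∈∁p ∘ x∈p─q⇒x∉q F T , F─T-nonempty , cond
    where
    cond : ∀ u → u ∈ Delete T → u ∉ F ─ T → ZeroOrAtLeastTwo ∣ N G u ∩ (F ─ T) ∣
    cond u u∈∁T u∉F─T = subst ZeroOrAtLeastTwo (∣N∩∣-cong F⇒F─T (λ _ → p─q⊆p F T)) (F-cond u ∈⊤ u∉F)
      where
      u∉T : u ∉ T
      u∉T = x∈∁p⇒x∉p u∈∁T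
      u∉F : u ∉ F
      u∉F u∈F = u∉F─T (x∈p∧x∉q⇒x∈p─q u∈F u∉T)
      F⇒F─T : ∀ {j} → u ∼ j → j ∈ F → j ∈ F ─ T
      F⇒F─T u∼j j∈F = x∈p∧x∉q⇒x∈p─q j∈F (F-nbr∉T u∉T u∼j j∈F)

  fortIn-Delete⇒fort-∪ : ∀ {T H A : Subset n} → FortIn G (Delete T) H → (∀ {u j} → u ∉ T → u ∼ j → j ∉ A) →
                         (∀ u → u ∈ T → u ∉ H ∪ A → ZeroOrAtLeastTwo ∣ N G u ∩ (H ∪ A) ∣) → Fort G (H ∪ A)
  fortIn-Delete⇒fort-∪ {T} {H} {A} (_ , (h , h∈H) , H-cond) A-unseen T-cond =
    (λ _ → ∈⊤) , (h , p⊆p∪q A h∈H) , cond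
    where
    cond : ∀ u → u ∈ ⊤ → u ∉ H ∪ A → ZeroOrAtLeastTwo ∣ N G u ∩ (H ∪ A) ∣
    cond u _ u∉H∪A with u ∈? T
    ... | yes u∈T = T-cond u u∈T u∉H∪A
    ... | no u∉T =
      subst ZeroOrAtLeastTwo (∣N∩∣-cong (λ _ → p⊆p∪q A) H∪A⇒H) (H-cond u (x∉p⇒x∈∁p u∉T) (u∉H∪A ∘ p⊆p∪q A))
      where
      H∪A⇒H : ∀ {j} → u ∼ j → j ∈ H ∪ A → j ∈ H
      H∪A⇒H u∼j j∈H∪A = [ id , (λ j∈A → contradiction j∈A (A-unseen u∉T u∼j)) ]′ (x∈p∪q⁻ H A j∈H∪A)

  fortIn-Delete⇒fort : ∀ {T H : Subset n} → FortIn G (Delete T) H →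
                       (∀ u → u ∈ T → ZeroOrAtLeastTwo ∣ N G u ∩ H ∣) → Fort G H
  fortIn-Delete⇒fort {T} {H} H-fort T-cond =
    subst (Fort G) (∪-identityʳ H) (fortIn-Delete⇒fort-∪ H-fort (λ _ _ → ∉⊥) T-cond-∪⊥)
    where
    T-cond-∪⊥ : ∀ u → u ∈ T → u ∉ H ∪ ⊥ → ZeroOrAtLeastTwo ∣ N G u ∩ (H ∪ ⊥) ∣
    T-cond-∪⊥ u u∈T _ = subst (λ K → ZeroOrAtLeastTwo ∣ N G u ∩ K ∣) (sym (∪-identityʳ H)) (T-cond u u∈T)

  module PendantPath (v w x : Fin n) (x≢v : x ≢ v)
    (v-nbrs : ∀ u → v ∼ u ⇔ (u ≡ w)) (w-nbrs : ∀ u → w ∼ u ⇔ (u ≡ v ⊎ u ≡ x)) where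

    T : Subset n
    T = triple v w x

    w∼v : w ∼ v
    w∼v = from (w-nbrs v) (inj₁ refl)

    w∼x : w ∼ x
    w∼x = from (w-nbrs x) (inj₂ refl)

    x≢w : x ≢ w
    x≢w = ∼⇒≢ (∼-sym w∼x)

    ∼v⇒≡w : ∀ {u} → u ∼ v → u ≡ w
    ∼v⇒≡w {u} u∼v = to (v-nbrs u) (∼-sym u∼v)

    2≤∣Nw∣ : 2 ≤ ∣ N G w ∣
    2≤∣Nw∣ = x∈p∧y∈p∧x≢y⇒2≤∣p∣ (∼⇒∈N w∼v) (∼⇒∈N w∼x) (x≢v ∘ sym)

    v-nbr∈T : ∀ {j} → v ∼ j → j ∈ T
    v-nbr∈T {j} v∼j = subst (_∈ T) (sym (to (v-nbrs j) v∼j)) (b∈triple v w x)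

    w-nbr∈T : ∀ {j} → w ∼ j → j ∈ T
    w-nbr∈T {j} w∼j = [ (λ { refl → a∈triple v w x }) , (λ { refl → c∈triple v w x }) ]′ (to (w-nbrs j) w∼j)

    ∉T⇒≁v : ∀ {u} → u ∉ T → ¬ u ∼ v
    ∉T⇒≁v u∉T = u∉T ∘ v-nbr∈T ∘ ∼-sym

    ∉T⇒≁w : ∀ {u} → u ∉ T → ¬ u ∼ w
    ∉T⇒≁w u∉T = u∉T ∘ w-nbr∈T ∘ ∼-sym

    x-nbr≢w⇒∉T : ∀ {j} → x ∼ j → j ≢ w → j ∉ T
    x-nbr≢w⇒∉T x∼j j≢w = ∉triple (λ { refl → x≢w (∼v⇒≡w x∼j) }) j≢w (λ { refl → ∼⇒≢ x∼j refl })

    vw : Subset n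
    vw = ⁅ v ⁆ ∪ ⁅ w ⁆

    v∈vw : v ∈ vw
    v∈vw = x∈p∪q⁺ (inj₁ (x∈⁅x⁆ v))

    w∈vw : w ∈ vw
    w∈vw = x∈p∪q⁺ (inj₂ (x∈⁅x⁆ w))

    ∉T⇒∉vw : ∀ {u j} → u ∉ T → u ∼ j → j ∉ vw
    ∉T⇒∉vw u∉T u∼j = [ (λ { refl → ∉T⇒≁v u∉T u∼j }) , (λ { refl → ∉T⇒≁w u∉T u∼j }) ]′ ∘ ∈⁅a⁆∪⁅b⁆⁻

    vw⊆T : vw ⊆ T
    vw⊆T = [ (λ { refl → a∈triple v w x }) , (λ { refl → b∈triple v w x }) ]′ ∘ ∈⁅a⁆∪⁅b⁆⁻

    module _ {H : Subset n} (H-fort : FortIn G (Delete T) H) where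

      ∈H⇒∉T : ∀ {h} → h ∈ H → h ∉ T
      ∈H⇒∉T = x∈∁p⇒x∉p ∘ proj₁ H-fort

      fort-if-x-unseen : Empty (N G x ∩ H) → Fort G H
      fort-if-x-unseen x-unseen = fortIn-Delete⇒fort H-fort (λ u u∈T → inj₁ (∣N∩∣≡0 (T-unseen u∈T)))
        where
        T-unseen : ∀ {u j} → u ∈ T → u ∼ j → j ∉ H
        T-unseen u∈T with ∈triple⁻ u∈T
        ... | inj₁ refl        = λ v∼j j∈H → ∈H⇒∉T j∈H (v-nbr∈T v∼j)
        ... | inj₂ (inj₁ refl) = λ w∼j j∈H → ∈H⇒∉T j∈H (w-nbr∈T w∼j)
        ... | inj₂ (inj₂ refl) = λ x∼j j∈H → x-unseen (_ , ∈N∩⁺ x∼j j∈H)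

      fort-∪-vw : ∀ {h} → x ∼ h → h ∈ H → Fort G (H ∪ vw)
      fort-∪-vw {h} x∼h h∈H = fortIn-Delete⇒fort-∪ H-fort ∉T⇒∉vw T-cond
        where
        T-cond : ∀ u → u ∈ T → u ∉ H ∪ vw → ZeroOrAtLeastTwo ∣ N G u ∩ (H ∪ vw) ∣
        T-cond u u∈T u∉H∪vw with ∈triple⁻ u∈T
        ... | inj₁ refl        = contradiction (q⊆p∪q H vw v∈vw) u∉H∪vw
        ... | inj₂ (inj₁ refl) = contradiction (q⊆p∪q H vw w∈vw) u∉H∪vw
        ... | inj₂ (inj₂ refl) =
          inj₂ (x∈p∧y∈p∧x≢y⇒2≤∣p∣ (∈N∩⁺ x∼h (p⊆p∪q vw h∈H)) (∈N∩⁺ (∼-sym w∼x) (q⊆p∪q H vw w∈vw)) h≢w)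
          where
          h≢w : h ≢ w
          h≢w refl = ∈H⇒∉T h∈H (b∈triple v w x)

    module _ {F : Subset n} (F-min : MinimalFort G F) (v∈F : v ∈ F) (w∈F : w ∈ F) where

      x∉F : x ∉ F
      x∉F x∈F = minimalFortIn⇒N⊈ F-min w∈F 2≤∣Nw∣ Nw⊆F
        where
        Nw⊆F : N G w ⊆ F
        Nw⊆F j∈ = [ (λ { refl → v∈F }) , (λ { refl → x∈F }) ]′ (to (w-nbrs _) (∈N⇒∼ j∈))

      F-nbr∉T : ∀ {u j} → u ∉ T → u ∼ j → j ∈ F → j ∉ T
      F-nbr∉T u∉T u∼j j∈F =
        ∉triple (λ { refl → ∉T⇒≁v u∉T u∼j }) (λ { refl → ∉T⇒≁w u∉T u∼j }) (λ { refl → x∉F j∈F })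

      F─T-nonempty : Nonempty (F ─ T)
      F─T-nonempty =
        let b , x∼b , b∈F , b≢w = fortIn-second-neighbour (proj₁ F-min) ∈⊤ x∉F (∼-sym w∼x) w∈F
        in b , x∈p∧x∉q⇒x∈p─q b∈F (x-nbr≢w⇒∉T x∼b b≢w)

      vw⊆F : vw ⊆ F
      vw⊆F = [ (λ { refl → v∈F }) , (λ { refl → w∈F }) ]′ ∘ ∈⁅a⁆∪⁅b⁆⁻

      no-fort-⊂-F─T : ∀ H → H ⊂ F ─ T → ¬ FortIn G (Delete T) H
      no-fort-⊂-F─T H H⊂F─T H-fort with nonempty? (N G x ∩ H)
      ... | yes (_ , h∈) = proj₂ F-min _ (q⊂p─r⇒q∪s⊂p H⊂F─T vw⊆F vw⊆T) (uncurry (fort-∪-vw H-fort) (∈N∩⁻ h∈))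
      ... | no x-unseen  = proj₂ F-min H (⊂-⊆-trans H⊂F─T (p─q⊆p F T)) (fort-if-x-unseen H-fort x-unseen)

lemma17 : ∀ {n} (G : Graph n) (v w x : Fin n) →
    ¬ (x ≡ v) →
    (∀ u → Adjacent G v u ⇔ (u ≡ w)) →
    (∀ u → Adjacent G w u ⇔ (u ≡ v ⊎ u ≡ x)) →
    (F : Subset n) → MinimalFort G F → v ∈ F → w ∈ F →
    MinimalFortIn G (Delete (triple v w x)) (F ─ triple v w x)
lemma17 G v w x x≢v v-nbrs w-nbrs F F-min v∈F w∈F =
  fort⇒fortIn-Delete G (proj₁ F-min) (F-nbr∉T F-min v∈F w∈F) (F─T-nonempty F-min v∈F w∈F) ,
  no-fort-⊂-F─T F-min v∈F w∈F
  where open PendantPath G v w x x≢v v-nbrs w-nbrs
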